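{- Assume $G$ is a graph and $f:V(G) \to \mathbb{N}$ is a mapping. Then $$ m_c(G,f) = \min\{\kappa(G,L): L \text{ is an } f\text{ -list assignment of } G\}.$$
   Context: The join $G \vee \overline{K_m}$ is obtained from the disjoint union of $G$ and the edgeless graph $\overline{K_m}$ by joining every vertex of $G$ to every vertex of $\overline{K_m}$. $f^{(m)}$ extends $f$ to $G \vee \overline{K_m}$ by $f^{(m)}(v)=|V(G)|$ on $\overline{K_m}$, and $m_c(G,f)$ is the minimum $m$ such that $G \vee \overline{K_m}$ is not $f^{(m)}$-choosable. An $f$-list assignment $L$ assigns to each $v$ a set of $f(v)$ colours; an $L$-colouring is a proper colouring $\phi$ with $\phi(v)\in L(v)$. $\Phi(G,L)=\{\phi(V(G)): \phi \text{ an } L\text{ -colouring of } G\}$, and $\kappa(G,L)=\infty$ if $G$ has an $L$-colouring $\phi$ with $|\phi(V(G))|<|V(G)|$, and $\kappa(G,L)=|\Phi(G,L)|$ otherwise (so $\kappa(G,L)=0$ if $G$ is not $L$-colourable). -}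

module Defs where

open import Data.Nat using (ℕ; _≤_; _<_)
open import Data.Fin using (Fin; splitAt)

open import Data.Bool using (Bool; true; false)
open import Data.Sum using (_⊎_; inj₁; inj₂; [_,_]′)
open import Data.List using (List; length; map; allFin)
open import Data.List.Membership.Propositional using (_∈_)
open import Data.List.Relation.Unary.Unique.Propositional using (Unique)
open import Data.Product using (Σ; ∃; _×_; _,_)
open import Data.Unit using (⊤)
open import Relation.Nullary using (¬_)
open import Relation.Binary.PropositionalEquality using (_≡_; _≢_; refl)
open import Function.Definitions using (Injective)

record Graph (n : ℕ) : Set where
  field
    adj    : Fin n → Fin n → Bool
    sym    : ∀ u v → adj u v ≡ adj v u
    irrefl : ∀ v → adj v v ≡ false
open Graph public

-- Join G ∨ K̄_m : vertices Fin (n + m); the first n are G, the last m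
-- form an independent set joined to every vertex of G.

joinAdj : ∀ {n} (G : Graph n) (m : ℕ) → Fin (n Data.Nat.+ m) → Fin (n Data.Nat.+ m) → Bool
joinAdj {n} G m u v with splitAt n u | splitAt n v
... | inj₁ a | inj₁ b = adj G a b
... | inj₁ _ | inj₂ _ = true
... | inj₂ _ | inj₁ _ = true
... | inj₂ _ | inj₂ _ = false

joinSym : ∀ {n} (G : Graph n) (m : ℕ) u v → joinAdj G m u v ≡ joinAdj G m v u
joinSym {n} G m u v with splitAt n u | splitAt n v
... | inj₁ a | inj₁ b = sym G a b
... | inj₁ _ | inj₂ _ = refl
... | inj₂ _ | inj₁ _ = refl
... | inj₂ _ | inj₂ _ = refl

joinIrrefl : ∀ {n} (G : Graph n) (m : ℕ) v → joinAdj G m v v ≡ false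
joinIrrefl {n} G m v with splitAt n v
... | inj₁ a = irrefl G a
... | inj₂ _ = refl

join : ∀ {n} → Graph n → (m : ℕ) → Graph (n Data.Nat.+ m)
join G m = record { adj = joinAdj G m ; sym = joinSym G m ; irrefl = joinIrrefl G m }

-- f^(m): equal to f on G and to |V(G)| = n on the vertices of K̄_m
extend : ∀ {n} → (Fin n → ℕ) → (m : ℕ) → Fin (n Data.Nat.+ m) → ℕ
extend {n} f m v = [ f , (λ _ → n) ]′ (splitAt n v)

IsFListAssignment : ∀ {n} → (Fin n → ℕ) → (Fin n → List ℕ) → Set
IsFListAssignment f L = ∀ v → Unique (L v) × length (L v) ≡ f v

IsLColouring : ∀ {n} → Graph n → (Fin n → List ℕ) → (Fin n → ℕ) → Set
IsLColouring G L φ = (∀ v → φ v ∈ L v) × (∀ u v → adj G u v ≡ true → φ u ≢ φ v)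

Choosable : ∀ {n} → Graph n → (Fin n → ℕ) → Set
Choosable G f = ∀ L → IsFListAssignment f L → ∃ λ φ → IsLColouring G L φ

data ℕ∞ : Set where
  fin : ℕ → ℕ∞
  ∞   : ℕ∞

data _≤∞_ : ℕ∞ → ℕ∞ → Set where
  fin≤fin : ∀ {a b} → a ≤ b → fin a ≤∞ fin b
  _≤∞∞    : ∀ x → x ≤∞ ∞

IsMin : (ℕ∞ → Set) → ℕ∞ → Set
IsMin P x = P x × (∀ y → P y → x ≤∞ y)

-- m_c(G,f): the minimum m with G ∨ K̄_m not f^(m)-choosable
-- (∞ if no such m exists)

NonChoosableAt : ∀ {n} → Graph n → (Fin n → ℕ) → ℕ∞ → Set
NonChoosableAt G f (fin m) = ¬ Choosable (join G m) (extend f m)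
NonChoosableAt G f ∞       = ⊤

image : ∀ {n} → (Fin n → ℕ) → List ℕ
image {n} φ = map φ (allFin n)

_≈ˢ_ : List ℕ → List ℕ → Set
A ≈ˢ B = ∀ c → (c ∈ A → c ∈ B) × (c ∈ B → c ∈ A)

-- |Φ(G,L)| = k : Fin k enumerates Φ(G,L) bijectively
PhiCard : ∀ {n} → Graph n → (Fin n → List ℕ) → ℕ → Set
PhiCard G L k =
  Σ (Fin k → List ℕ) λ S →
    (∀ i → ∃ λ φ → IsLColouring G L φ × (S i ≈ˢ image φ)) ×
    (∀ i j → S i ≈ˢ S j → i ≡ j) ×
    (∀ φ → IsLColouring G L φ → ∃ λ i → S i ≈ˢ image φ)

-- κ(G,L) = x.  |φ(V(G))| < |V(G)| iff φ is not injective.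
Kappa : ∀ {n} → Graph n → (Fin n → List ℕ) → ℕ∞ → Set
Kappa G L ∞       = ∃ λ φ → IsLColouring G L φ × ¬ Injective _≡_ _≡_ φ
Kappa G L (fin k) = (∀ φ → IsLColouring G L φ → Injective _≡_ _≡_ φ) × PhiCard G L k

KappaValue : ∀ {n} → Graph n → (Fin n → ℕ) → ℕ∞ → Set
KappaValue G f x = ∃ λ L → IsFListAssignment f L × Kappa G L x

-- If κ(G,L) = k is finite for an f-list assignment L, give the k vertices of K̄_k the colour sets
-- φ(V(G)) of representatives of the k classes of L-colourings: every L-colouring of G uses one of
-- these sets exactly, so the K̄_k-vertex carrying it cannot be coloured, and G ∨ K̄_k is not
-- f^(k)-choosable.  Conversely, let L' be an uncolourable f^(m)-list assignment of G ∨ K̄_m and L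
-- its restriction to G.  An L-colouring φ of G extends to G ∨ K̄_m unless the list of some vertex
-- of K̄_m lies inside φ(V(G)); having |V(G)| colours, that list then equals φ(V(G)) and φ is
-- injective.  Hence κ(G,L) is finite, and sending each class to such a vertex is injective, so
-- κ(G,L) ≤ m.  Constructively, L' is obtained from non-choosability because choosability is
-- decidable: every list assignment relabels injectively into colours below Σ f.
module Submission where

open import Defs hiding (sym)
open import Data.Nat using (ℕ; zero; suc; _+_; _≤_; _<_)
open import Data.Nat.Properties using (_≟_; ≤-trans; ≤-antisym; 1+n≰n)
open import Data.Nat.ListAction using (sum)
open import Data.Fin using (Fin; zero; suc; toℕ; splitAt; _↑ˡ_; _↑ʳ_; punchOut)
open import Data.Fin.Properties
  using (any?; all?; toℕ<n; toℕ-injective; splitAt-↑ˡ; splitAt-↑ʳ; join-splitAt; punchOut-injective; injective⇒≤)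
  renaming (_≟_ to _≟ᶠ_)
open import Data.Bool using (true)
open import Data.Bool.Properties using () renaming (_≟_ to _≟ᵇ_)
open import Data.Sum using (_⊎_; inj₁; inj₂)
open import Data.Product using (∃; _×_; _,_; proj₁; proj₂)
open import Data.Unit using (tt)
open import Data.Empty using (⊥-elim)
open import Data.List using (List; []; _∷_; [_]; length; map; allFin; lookup; concat; filter; upTo; deduplicate; cartesianProductWith)
open import Data.List.Properties using (length-map; length-tabulate; length-++; length-upTo; map-cong)
open import Data.List.Membership.Propositional using (_∈_; _∉_; find; lose)
open import Data.List.Membership.Propositional.Properties
  using (∈-map⁺; ∈-map⁻; ∈-allFin; ∈-lookup; ∈-concat⁺′; ∈-upTo⁺; ∈-filter⁺; ∈-filter⁻; ∈-deduplicate⁻;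
         ∈-cartesianProductWith⁺; ∈-cartesianProductWith⁻)
open import Data.List.Membership.DecPropositional _≟_ using (_∈?_)
open import Data.List.Relation.Unary.All as All using (All; []; _∷_)
open import Data.List.Relation.Unary.All.Properties using (¬All⇒Any¬)
open import Data.List.Relation.Unary.AllPairs using ([]; _∷_)
open import Data.List.Relation.Unary.Any as Any using (Any; here; there)
open import Data.List.Relation.Unary.Any.Properties using (lookup-index) renaming (map⁺ to Any-map⁺; deduplicate⁺ to Any-deduplicate⁺)
open import Data.List.Relation.Unary.Unique.Propositional using (Unique)
open import Data.List.Relation.Unary.Unique.DecPropositional _≟_ using (unique?)
import Data.List.Relation.Unary.Unique.Propositional.Properties as Unique
import Data.List.Relation.Unary.Unique.Setoid as SetoidUnique
open import Data.List.Relation.Unary.Unique.DecSetoid.Properties using (deduplicate-!)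
open import Data.Vec.Functional using (_++_) renaming (_∷_ to _◂_)
open import Data.Vec.Functional.Properties using (lookup-++ˡ; lookup-++ʳ)
open import Function using (_∘_)
open import Function.Bundles using (_⇔_; mk⇔)
open import Function.Definitions using (Injective)
open import Relation.Binary using (Setoid; DecSetoid)
open import Relation.Binary.PropositionalEquality using (_≡_; _≢_; _≗_; refl; sym; trans; cong; subst; subst₂; setoid)
open import Relation.Nullary using (¬_; Dec; yes; no; contradiction)
open import Relation.Nullary.Decidable using (_×-dec_; _→-dec_; ¬?; map′; decidable-stable)

≤∞-trans : ∀ {x y z} → x ≤∞ y → y ≤∞ z → x ≤∞ z
≤∞-trans (fin≤fin x≤y) (fin≤fin y≤z) = fin≤fin (≤-trans x≤y y≤z)
≤∞-trans {x} _ (_ ≤∞∞) = x ≤∞∞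

≤∞-antisym : ∀ {x y} → x ≤∞ y → y ≤∞ x → x ≡ y
≤∞-antisym (fin≤fin x≤y) (fin≤fin y≤x) = cong fin (≤-antisym x≤y y≤x)
≤∞-antisym (_ ≤∞∞) (_ ≤∞∞) = refl

IsMin-coinitial : ∀ {P Q : ℕ∞ → Set} → (∀ {y} → Q y → P y) → (∀ {y} → P y → ∃ λ z → Q z × z ≤∞ y) →
  ∀ x → IsMin P x ⇔ IsMin Q x
IsMin-coinitial {P} {Q} Q⊆P P⇒Q≤ x = mk⇔ to from
  where
  to : IsMin P x → IsMin Q x
  to (Px , x-least) with P⇒Q≤ Px
  ... | z , Qz , z≤x = subst Q (≤∞-antisym z≤x (x-least z (Q⊆P Qz))) Qz , λ y Qy → x-least y (Q⊆P Qy)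
  from : IsMin Q x → IsMin P x
  from (Qx , x-least) = Q⊆P Qx , λ y Py → let (z , Qz , z≤y) = P⇒Q≤ Py in ≤∞-trans (x-least z Qz) z≤y

injective⇒surjective : ∀ {n} {p : Fin n → Fin n} → Injective _≡_ _≡_ p → ∀ j → ∃ λ i → p i ≡ j
injective⇒surjective {suc n} {p} p-injective j with any? (λ i → p i ≟ᶠ j)
... | yes hit = hit
... | no miss = contradiction (injective⇒≤ punchOut∘p-injective) 1+n≰n
  where
  j≢p : ∀ i → j ≢ p i
  j≢p i j≡pi = miss (i , sym j≡pi)
  punchOut∘p-injective : Injective _≡_ _≡_ (λ i → punchOut (j≢p i))
  punchOut∘p-injective {i} {i′} eq = p-injective (punchOut-injective (j≢p i) (j≢p i′) eq)

lookup-injective : ∀ {a ℓ} (S : Setoid a ℓ) {xs} → SetoidUnique.Unique S xs →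
  ∀ i j → Setoid._≈_ S (lookup xs i) (lookup xs j) → i ≡ j
lookup-injective S (_ ∷ _) zero zero _ = refl
lookup-injective S (x≉ ∷ _) zero (suc j) x≈ = contradiction x≈ (All.lookup x≉ (∈-lookup j))
lookup-injective S (x≉ ∷ _) (suc i) zero ≈x = contradiction (Setoid.sym S ≈x) (All.lookup x≉ (∈-lookup i))
lookup-injective S (_ ∷ xs!) (suc i) (suc j) eq = cong suc (lookup-injective S xs! i j eq)

Unique-map⁺-injectiveOn : ∀ {A B : Set} {f : A → B} {xs} →
  (∀ {x y} → x ∈ xs → y ∈ xs → f x ≡ f y → x ≡ y) → Unique xs → Unique (map f xs)
Unique-map⁺-injectiveOn {xs = []} _ [] = []
Unique-map⁺-injectiveOn {f = f} {xs = x ∷ xs} f-injective (x∉ ∷ xs!) =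
  All.tabulate (λ y∈ fx≡y → let (z , z∈ , y≡fz) = ∈-map⁻ f y∈ in
    All.lookup x∉ z∈ (f-injective (here refl) (there z∈) (trans fx≡y y≡fz)))
  ∷ Unique-map⁺-injectiveOn (λ x∈ y∈ → f-injective (there x∈) (there y∈)) xs!

length-concat-map : ∀ {A B : Set} (L : B → List A) xs → length (concat (map L xs)) ≡ sum (map (length ∘ L) xs)
length-concat-map L [] = refl
length-concat-map L (x ∷ xs) = trans (length-++ (L x)) (cong (length (L x) +_) (length-concat-map L xs))

words : ∀ {A : Set} → ℕ → List A → List (List A)
words zero    X = [ [] ]
words (suc k) X = cartesianProductWith _∷_ X (words k X)

∈-words⁺ : ∀ {A : Set} {X : List A} {k} xs → length xs ≡ k → All (_∈ X) xs → xs ∈ words k X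
∈-words⁺ [] refl [] = here refl
∈-words⁺ (x ∷ xs) refl (x∈ ∷ xs⊆) = ∈-cartesianProductWith⁺ _∷_ x∈ (∈-words⁺ xs refl xs⊆)

choices : ∀ {n} {A : Set} → (Fin n → List A) → List (Fin n → A)
choices {zero}  Xs = [ (λ ()) ]
choices {suc n} Xs = cartesianProductWith _◂_ (Xs zero) (choices (Xs ∘ suc))

∈-choices⁻ : ∀ {n} {A : Set} (Xs : Fin n → List A) {φ} → φ ∈ choices Xs → ∀ v → φ v ∈ Xs v
∈-choices⁻ {suc n} Xs φ∈ v with ∈-cartesianProductWith⁻ _◂_ (Xs zero) (choices (Xs ∘ suc)) φ∈
... | a , ψ , a∈ , ψ∈ , refl with v
... | zero  = a∈
... | suc v = ∈-choices⁻ (Xs ∘ suc) ψ∈ v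

∈-choices⁺ : ∀ {n} {A : Set} (Xs : Fin n → List A) {φ} → (∀ v → φ v ∈ Xs v) →
  ∃ λ ψ → ψ ∈ choices Xs × ψ ≗ φ
∈-choices⁺ {zero} Xs _ = (λ ()) , here refl , λ ()
∈-choices⁺ {suc n} Xs {φ} φ∈ with ∈-choices⁺ (Xs ∘ suc) (φ∈ ∘ suc)
... | ψ , ψ∈ , ψ≗ =
  φ zero ◂ ψ , ∈-cartesianProductWith⁺ _◂_ (φ∈ zero) ψ∈ , λ { zero → refl ; (suc v) → ψ≗ v }

injective? : ∀ {n} (φ : Fin n → ℕ) → Dec (Injective _≡_ _≡_ φ)
injective? φ = map′ (λ inj {i} {j} → inj i j) (λ inj i j → inj)
  (all? λ i → all? λ j → (φ i ≟ φ j) →-dec (i ≟ᶠ j))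

module _ {n} (G : Graph n) where

  IsLColouring-resp : ∀ {L M φ ψ} → L ≗ M → φ ≗ ψ → IsLColouring G L φ → IsLColouring G M ψ
  IsLColouring-resp L≗M φ≗ψ (φ∈ , proper) =
    (λ v → subst₂ _∈_ (φ≗ψ v) (L≗M v) (φ∈ v)) ,
    λ u v uv ψu≡ψv → proper u v uv (trans (φ≗ψ u) (trans ψu≡ψv (sym (φ≗ψ v))))

  isLColouring? : ∀ L φ → Dec (IsLColouring G L φ)
  isLColouring? L φ =
    all? (λ v → φ v ∈? L v) ×-dec all? λ u → all? λ v → (adj G u v ≟ᵇ true) →-dec ¬? (φ u ≟ φ v)

  colourings : (Fin n → List ℕ) → List (Fin n → ℕ)
  colourings L = filter (isLColouring? L) (choices L)

  ∈-colourings⁻ : ∀ {L φ} → φ ∈ colourings L → IsLColouring G L φ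
  ∈-colourings⁻ {L} φ∈ = proj₂ (∈-filter⁻ (isLColouring? L) {xs = choices L} φ∈)

  ∈-colourings⁺ : ∀ {L φ} → IsLColouring G L φ → ∃ λ ψ → ψ ∈ colourings L × ψ ≗ φ
  ∈-colourings⁺ {L} col with ∈-choices⁺ L (proj₁ col)
  ... | ψ , ψ∈ , ψ≗φ =
    ψ , ∈-filter⁺ (isLColouring? L) ψ∈ (IsLColouring-resp (λ _ → refl) (sym ∘ ψ≗φ) col) , ψ≗φ

  colourable? : ∀ L → Dec (∃ (IsLColouring G L))
  colourable? L = map′ (λ some → let (φ , φ∈ , _) = find some in φ , ∈-colourings⁻ φ∈)
    (λ (φ , col) → let (ψ , ψ∈ , _) = ∈-colourings⁺ col in lose ψ∈ tt)
    (Any.any? (λ _ → yes tt) (colourings L))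

_⊆?_ : (A B : List ℕ) → Dec (∀ c → c ∈ A → c ∈ B)
A ⊆? B = map′ (λ A⊆B _ → All.lookup A⊆B) (λ A⊆B → All.tabulate (A⊆B _)) (All.all? (_∈? B) A)

≈ˢ-decSetoid : DecSetoid _ _
≈ˢ-decSetoid = record
  { Carrier = List ℕ
  ; _≈_ = _≈ˢ_
  ; isDecEquivalence = record
    { isEquivalence = record
      { refl = λ _ → (λ c∈ → c∈) , (λ c∈ → c∈)
      ; sym = λ A≈B c → proj₂ (A≈B c) , proj₁ (A≈B c)
      ; trans = λ A≈B B≈C c → proj₁ (B≈C c) ∘ proj₁ (A≈B c) , proj₂ (A≈B c) ∘ proj₂ (B≈C c)
      }
    ; _≟_ = λ A B → map′ (λ (A⊆B , B⊆A) c → A⊆B c , B⊆A c) (λ A≈B → proj₁ ∘ A≈B , proj₂ ∘ A≈B)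
                         ((A ⊆? B) ×-dec (B ⊆? A))
    }
  }

open DecSetoid ≈ˢ-decSetoid using ()
  renaming (setoid to ≈ˢ-setoid; reflexive to ≡⇒≈ˢ; sym to ≈ˢ-sym; trans to ≈ˢ-trans; _≟_ to _≈ˢ?_)

∈-resp-≈ˢ : ∀ {A B c} → A ≈ˢ B → c ∈ A → c ∈ B
∈-resp-≈ˢ A≈B = proj₁ (A≈B _)

image-unique : ∀ {n} {φ : Fin n → ℕ} → Injective _≡_ _≡_ φ → Unique (image φ)
image-unique {n} φ-injective = Unique.map⁺ φ-injective (Unique.allFin⁺ n)

image-length : ∀ {n} (φ : Fin n → ℕ) → length (image φ) ≡ n
image-length {n} φ = trans (length-map φ (allFin n)) (length-tabulate (λ i → i))

⊆image⇒injective×≈ˢ : ∀ {n} {φ : Fin n → ℕ} {A} → Unique A × length A ≡ n → All (_∈ image φ) A →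
  Injective _≡_ _≡_ φ × A ≈ˢ image φ
⊆image⇒injective×≈ˢ {φ = φ} {A} (A! , refl) A⊆ = φ-injective , λ c → All.lookup A⊆ , image⊆A
  where
  preimage : ∀ i → ∃ λ v → lookup A i ≡ φ v
  preimage i = let (v , _ , eq) = ∈-map⁻ φ (All.lookup A⊆ (∈-lookup i)) in v , eq
  p : Fin (length A) → Fin (length A)
  p i = proj₁ (preimage i)
  lookup≡φ∘p : ∀ i → lookup A i ≡ φ (p i)
  lookup≡φ∘p i = proj₂ (preimage i)
  p-injective : Injective _≡_ _≡_ p
  p-injective {i} {j} pi≡pj =
    lookup-injective (setoid ℕ) A! i j (trans (lookup≡φ∘p i) (trans (cong φ pi≡pj) (sym (lookup≡φ∘p j))))
  φ-injective : Injective _≡_ _≡_ φ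
  φ-injective {u} {v} φu≡φv with injective⇒surjective p-injective u | injective⇒surjective p-injective v
  ... | i , refl | j , refl =
    cong p (lookup-injective (setoid ℕ) A! i j (trans (lookup≡φ∘p i) (trans φu≡φv (sym (lookup≡φ∘p j)))))
  image⊆A : ∀ {c} → c ∈ image φ → c ∈ A
  image⊆A c∈ with ∈-map⁻ φ c∈
  ... | u , _ , refl with injective⇒surjective p-injective u
  ... | i , refl = subst (_∈ A) (lookup≡φ∘p i) (∈-lookup i)

kappa-exists : ∀ {n} (G : Graph n) L → ∃ (Kappa G L)
kappa-exists {n} G L with Any.any? (λ φ → ¬? (injective? φ)) (colourings G L)
... | yes some = let (φ , φ∈ , ¬injective) = find some in ∞ , φ , ∈-colourings⁻ G φ∈ , ¬injective
... | no none = fin (length Φ) , all-injective , lookup Φ , represented , distinct , classified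
  where
  Φ : List (List ℕ)
  Φ = deduplicate _≈ˢ?_ (map image (colourings G L))
  all-injective : ∀ φ → IsLColouring G L φ → Injective _≡_ _≡_ φ
  all-injective φ col {u} {v} φu≡φv with ∈-colourings⁺ G col
  ... | ψ , ψ∈ , ψ≗φ =
    decidable-stable (injective? ψ) (none ∘ lose ψ∈) (trans (ψ≗φ u) (trans φu≡φv (sym (ψ≗φ v))))
  represented : ∀ i → ∃ λ φ → IsLColouring G L φ × lookup Φ i ≈ˢ image φ
  represented i with ∈-map⁻ image (∈-deduplicate⁻ _≈ˢ?_ _ (∈-lookup i))
  ... | φ , φ∈ , eq = φ , ∈-colourings⁻ G φ∈ , ≡⇒≈ˢ eq
  distinct : ∀ i j → lookup Φ i ≈ˢ lookup Φ j → i ≡ j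
  distinct = lookup-injective ≈ˢ-setoid (deduplicate-! ≈ˢ-decSetoid (map image (colourings G L)))
  classified : ∀ φ → IsLColouring G L φ → ∃ λ i → lookup Φ i ≈ˢ image φ
  classified φ col with ∈-colourings⁺ G col
  ... | ψ , ψ∈ , ψ≗φ = Any.index inΦ , lookup-index inΦ
    where
    inΦ : Any (_≈ˢ image φ) Φ
    inΦ = Any-deduplicate⁺ _≈ˢ?_ (λ y≈x x≈ → ≈ˢ-trans y≈x x≈)
            (Any-map⁺ (lose ψ∈ (≡⇒≈ˢ (map-cong ψ≗φ (allFin n)))))

module _ {n m : ℕ} where

  ++-assignment : ∀ {f : Fin n → ℕ} {L : Fin n → List ℕ} {R : Fin m → List ℕ} → IsFListAssignment f L →
    (∀ w → Unique (R w) × length (R w) ≡ n) → IsFListAssignment (extend f m) (L ++ R)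
  ++-assignment L-assign R-assign u with splitAt n u
  ... | inj₁ v = L-assign v
  ... | inj₂ w = R-assign w

  restrict-assignment : ∀ {f : Fin n → ℕ} {L′ : Fin (n + m) → List ℕ} → IsFListAssignment (extend f m) L′ →
    IsFListAssignment f (L′ ∘ (_↑ˡ m))
  restrict-assignment {f} L′-assign v =
    proj₁ (L′-assign (v ↑ˡ m)) , trans (proj₂ (L′-assign (v ↑ˡ m))) (lookup-++ˡ f (λ _ → n) v)

  new-vertex-assignment : ∀ {f : Fin n → ℕ} {L′ : Fin (n + m) → List ℕ} → IsFListAssignment (extend f m) L′ →
    ∀ w → Unique (L′ (n ↑ʳ w)) × length (L′ (n ↑ʳ w)) ≡ n
  new-vertex-assignment {f} L′-assign w =
    proj₁ (L′-assign (n ↑ʳ w)) , trans (proj₂ (L′-assign (n ↑ʳ w))) (lookup-++ʳ f (λ _ → n) w)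

module _ {n} (G : Graph n) (m : ℕ) where

  join-adj-↑ˡ : ∀ u v → adj (join G m) (u ↑ˡ m) (v ↑ˡ m) ≡ adj G u v
  join-adj-↑ˡ u v rewrite splitAt-↑ˡ n u m | splitAt-↑ˡ n v m = refl

  join-adj-↑ˡ-↑ʳ : ∀ v w → adj (join G m) (v ↑ˡ m) (n ↑ʳ w) ≡ true
  join-adj-↑ˡ-↑ʳ v w rewrite splitAt-↑ˡ n v m | splitAt-↑ʳ n m w = refl

  restrict-colouring : ∀ {L′ ψ} → IsLColouring (join G m) L′ ψ →
    IsLColouring G (L′ ∘ (_↑ˡ m)) (ψ ∘ (_↑ˡ m))
  restrict-colouring (ψ∈ , proper) =
    ψ∈ ∘ (_↑ˡ m) , λ u v uv → proper (u ↑ˡ m) (v ↑ˡ m) (trans (join-adj-↑ˡ u v) uv)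

  extend-colouring : ∀ {L′ : Fin (n + m) → List ℕ} {φ} → IsLColouring G (L′ ∘ (_↑ˡ m)) φ →
    (∀ w → ∃ λ c → c ∈ L′ (n ↑ʳ w) × c ∉ image φ) → ∃ (IsLColouring (join G m) L′)
  extend-colouring {L′} {φ} (φ∈ , proper) fresh = ψ , ψ∈ , ψ-proper
    where
    ψ : Fin (n + m) → ℕ
    ψ = φ ++ (proj₁ ∘ fresh)
    ψ∈ : ∀ u → ψ u ∈ L′ u
    ψ∈ u with splitAt n u | join-splitAt n m u
    ... | inj₁ v | refl = φ∈ v
    ... | inj₂ w | refl = proj₁ (proj₂ (fresh w))
    ψ-proper : ∀ u u′ → adj (join G m) u u′ ≡ true → ψ u ≢ ψ u′
    ψ-proper u u′ with splitAt n u | splitAt n u′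
    ... | inj₁ v | inj₁ v′ = proper v v′
    ... | inj₁ v | inj₂ w  = λ _ φv≡c →
      proj₂ (proj₂ (fresh w)) (subst (_∈ image φ) φv≡c (∈-map⁺ φ (∈-allFin v)))
    ... | inj₂ w | inj₁ v  = λ _ c≡φv →
      proj₂ (proj₂ (fresh w)) (subst (_∈ image φ) (sym c≡φv) (∈-map⁺ φ (∈-allFin v)))
    ... | inj₂ _ | inj₂ _  = λ ()

kappa⇒notChoosable : ∀ {n k} (G : Graph n) (f : Fin n → ℕ) {L} → IsFListAssignment f L → Kappa G L (fin k) →
  ¬ Choosable (join G k) (extend f k)
kappa⇒notChoosable {n} {k} G f {L} L-assign (all-injective , _ , represented , _ , classified) choosable =
  uncolourable (proj₂ (choosable L′ L′-assign))
  where
  rep : Fin k → Fin n → ℕ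
  rep i = proj₁ (represented i)
  L′ : Fin (n + k) → List ℕ
  L′ = L ++ (image ∘ rep)
  L′-assign : IsFListAssignment (extend f k) L′
  L′-assign = ++-assignment L-assign λ i →
    image-unique (all-injective (rep i) (proj₁ (proj₂ (represented i)))) , image-length (rep i)
  uncolourable : ∀ {ψ} → ¬ IsLColouring (join G k) L′ ψ
  uncolourable {ψ} ψ-col@(ψ∈ , proper) = proper (v ↑ˡ k) (n ↑ʳ i) (join-adj-↑ˡ-↑ʳ G k v i) (sym c≡φv)
    where
    φ : Fin n → ℕ
    φ = ψ ∘ (_↑ˡ k)
    φ-col : IsLColouring G L φ
    φ-col = IsLColouring-resp G (lookup-++ˡ L _) (λ _ → refl) (restrict-colouring G k ψ-col)
    i : Fin k
    i = proj₁ (classified φ φ-col)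
    c∈φ : ψ (n ↑ʳ i) ∈ image φ
    c∈φ = ∈-resp-≈ˢ (≈ˢ-trans (≈ˢ-sym (proj₂ (proj₂ (represented i)))) (proj₂ (classified φ φ-col)))
            (subst (ψ (n ↑ʳ i) ∈_) (lookup-++ʳ L _ i) (ψ∈ (n ↑ʳ i)))
    v : Fin n
    v = proj₁ (∈-map⁻ φ c∈φ)
    c≡φv : ψ (n ↑ʳ i) ≡ φ v
    c≡φv = proj₂ (proj₂ (∈-map⁻ φ c∈φ))

module _ {n m} (G : Graph n) (f : Fin n → ℕ) {L′ : Fin (n + m) → List ℕ}
         (L′-assign : IsFListAssignment (extend f m) L′)
         (uncolourable : ¬ ∃ (IsLColouring (join G m) L′)) where

  private
    L : Fin n → List ℕ
    L = L′ ∘ (_↑ˡ m)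

  saturated-vertex : ∀ {φ} → IsLColouring G L φ → ∃ λ w → Injective _≡_ _≡_ φ × L′ (n ↑ʳ w) ≈ˢ image φ
  saturated-vertex {φ} φ-col with any? (λ w → All.all? (_∈? image φ) (L′ (n ↑ʳ w)))
  ... | yes (w , covered) = w , ⊆image⇒injective×≈ˢ (new-vertex-assignment L′-assign w) covered
  ... | no uncovered = ⊥-elim (uncolourable (extend-colouring G m φ-col fresh))
    where
    fresh : ∀ w → ∃ λ c → c ∈ L′ (n ↑ʳ w) × c ∉ image φ
    fresh w = find (¬All⇒Any¬ (_∈? image φ) _ (λ covered → uncovered (w , covered)))

  -- distinct classes of colourings saturate distinct vertices of K̄_m
  kappa≤m : ∀ {k} → Kappa G L (fin k) → k ≤ m
  kappa≤m {k} (_ , S , represented , distinct , _) = injective⇒≤ vertex-injective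
    where
    vertex : Fin k → Fin m
    vertex i = proj₁ (saturated-vertex (proj₁ (proj₂ (represented i))))
    S≈vertex : ∀ i → S i ≈ˢ L′ (n ↑ʳ vertex i)
    S≈vertex i = ≈ˢ-trans (proj₂ (proj₂ (represented i)))
                   (≈ˢ-sym (proj₂ (proj₂ (saturated-vertex (proj₁ (proj₂ (represented i)))))))
    vertex-injective : Injective _≡_ _≡_ vertex
    vertex-injective {i} {j} eq =
      distinct i j (≈ˢ-trans (S≈vertex i) (≈ˢ-trans (≡⇒≈ˢ (cong (L′ ∘ (n ↑ʳ_)) eq)) (≈ˢ-sym (S≈vertex j))))

  uncolourable-join⇒kappa≤ : ∃ λ y → KappaValue G f y × y ≤∞ fin m
  uncolourable-join⇒kappa≤ with kappa-exists G L
  ... | ∞ , φ , φ-col , ¬injective = ⊥-elim (¬injective (proj₁ (proj₂ (saturated-vertex φ-col))))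
  ... | fin k , κ = fin k , (L , restrict-assignment L′-assign , κ) , fin≤fin (kappa≤m κ)

isFListAssignment? : ∀ {N} (g : Fin N → ℕ) L → Dec (IsFListAssignment g L)
isFListAssignment? g L = all? λ u → unique? (L u) ×-dec (length (L u) ≟ g u)

module _ (X : List ℕ) where

  position : ℕ → ℕ
  position c with c ∈? X
  ... | yes c∈X = toℕ (Any.index c∈X)
  ... | no  _   = 0

  position< : ∀ {c} → c ∈ X → position c < length X
  position< {c} c∈X with c ∈? X
  ... | yes c∈X′ = toℕ<n (Any.index c∈X′)
  ... | no  c∉X  = contradiction c∈X c∉X

  position-injective : ∀ {c d} → c ∈ X → d ∈ X → position c ≡ position d → c ≡ d
  position-injective {c} {d} c∈X d∈X eq with c ∈? X | d ∈? X
  ... | yes c∈X′ | yes d∈X′ =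
    trans (lookup-index c∈X′) (trans (cong (lookup X) (toℕ-injective eq)) (sym (lookup-index d∈X′)))
  ... | no c∉X | _ = contradiction c∈X c∉X
  ... | _ | no d∉X = contradiction d∈X d∉X

module _ {N} (H : Graph N) (ρ : ℕ → ℕ) {L : Fin N → List ℕ} where

  relabel-assignment : ∀ {g} → (∀ u {c d} → c ∈ L u → d ∈ L u → ρ c ≡ ρ d → c ≡ d) →
    IsFListAssignment g L → IsFListAssignment g (map ρ ∘ L)
  relabel-assignment ρ-injective L-assign u =
    Unique-map⁺-injectiveOn (ρ-injective u) (proj₁ (L-assign u)) , trans (length-map ρ (L u)) (proj₂ (L-assign u))

  unrelabel-colouring : ∀ {ψ} → IsLColouring H (map ρ ∘ L) ψ → ∃ (IsLColouring H L)
  unrelabel-colouring {ψ} (ψ∈ , proper) = φ , φ∈ , λ u v uv φu≡φv →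
    proper u v uv (trans (ψ≡ρ∘φ u) (trans (cong ρ φu≡φv) (sym (ψ≡ρ∘φ v))))
    where
    preimage : ∀ u → ∃ λ c → c ∈ L u × ψ u ≡ ρ c
    preimage u = ∈-map⁻ ρ (ψ∈ u)
    φ : Fin N → ℕ
    φ u = proj₁ (preimage u)
    φ∈ : ∀ u → φ u ∈ L u
    φ∈ u = proj₁ (proj₂ (preimage u))
    ψ≡ρ∘φ : ∀ u → ψ u ≡ ρ (φ u)
    ψ≡ρ∘φ u = proj₂ (proj₂ (preimage u))

assignmentsBelow : ∀ {N} → (Fin N → ℕ) → ℕ → List (Fin N → List ℕ)
assignmentsBelow g B = choices (λ u → words (g u) (upTo B))

∈-assignmentsBelow⁺ : ∀ {N} {g : Fin N → ℕ} {B L} → IsFListAssignment g L → (∀ u → All (_< B) (L u)) →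
  ∃ λ M → M ∈ assignmentsBelow g B × M ≗ L
∈-assignmentsBelow⁺ L-assign L<B = ∈-choices⁺ _ λ u → ∈-words⁺ _ (proj₂ (L-assign u)) (All.map ∈-upTo⁺ (L<B u))

colourBound : ∀ {N} → (Fin N → ℕ) → ℕ
colourBound {N} g = sum (map g (allFin N))

bounded-colourable⇒choosable : ∀ {N} (H : Graph N) (g : Fin N → ℕ) →
  (∀ {L} → L ∈ assignmentsBelow g (colourBound g) → IsFListAssignment g L → ∃ (IsLColouring H L)) →
  Choosable H g
bounded-colourable⇒choosable {N} H g colourable L L-assign = unrelabel-colouring H ρ (proj₂ L₀-colourable)
  where
  X : List ℕ
  X = concat (map L (allFin N))
  ρ : ℕ → ℕ
  ρ = position X
  ∈X : ∀ {u c} → c ∈ L u → c ∈ X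
  ∈X {u} c∈ = ∈-concat⁺′ c∈ (∈-map⁺ L (∈-allFin u))
  |X|≡Σg : length X ≡ colourBound g
  |X|≡Σg = trans (length-concat-map L (allFin N)) (cong sum (map-cong (proj₂ ∘ L-assign) (allFin N)))
  L₀-assign : IsFListAssignment g (map ρ ∘ L)
  L₀-assign = relabel-assignment H ρ (λ u c∈ d∈ → position-injective X (∈X c∈) (∈X d∈)) L-assign
  L₀-bounded : ∀ u → All (_< colourBound g) (map ρ (L u))
  L₀-bounded u = All.tabulate λ c∈ →
    let (c , c∈L , eq) = ∈-map⁻ ρ c∈ in subst₂ _<_ (sym eq) |X|≡Σg (position< X (∈X c∈L))
  L₀-colourable : ∃ (IsLColouring H (map ρ ∘ L))
  L₀-colourable with ∈-assignmentsBelow⁺ L₀-assign L₀-bounded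
  ... | M , M∈ , M≗L₀ =
    let (ψ , ψ-col) = colourable M∈ (λ u → subst (λ A → Unique A × length A ≡ g u) (sym (M≗L₀ u)) (L₀-assign u))
    in ψ , IsLColouring-resp H M≗L₀ (λ _ → refl) ψ-col

choosable⊎counterexample : ∀ {N} (H : Graph N) (g : Fin N → ℕ) →
  Choosable H g ⊎ ∃ λ L → IsFListAssignment g L × ¬ ∃ (IsLColouring H L)
choosable⊎counterexample H g
  with Any.any? (λ L → isFListAssignment? g L ×-dec ¬? (colourable? H L)) (assignmentsBelow g (colourBound g))
... | yes bad = let (L , _ , L-assign , ¬colourable) = find bad in inj₂ (L , L-assign , ¬colourable)
... | no ¬bad = inj₁ (bounded-colourable⇒choosable H g λ L∈ L-assign →
                  decidable-stable (colourable? H _) (λ ¬colourable → ¬bad (lose L∈ (L-assign , ¬colourable))))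

module _ {n} (G : Graph n) (f : Fin n → ℕ) where

  kappaValue⇒nonChoosable : ∀ {y} → KappaValue G f y → NonChoosableAt G f y
  kappaValue⇒nonChoosable {fin k} (L , L-assign , κ) = kappa⇒notChoosable G f L-assign κ
  kappaValue⇒nonChoosable {∞} _ = tt

  nonChoosable⇒kappaValue≤ : ∀ {y} → NonChoosableAt G f y → ∃ λ z → KappaValue G f z × z ≤∞ y
  nonChoosable⇒kappaValue≤ {fin m} ¬choosable with choosable⊎counterexample (join G m) (extend f m)
  ... | inj₁ choosable = ⊥-elim (¬choosable choosable)
  ... | inj₂ (L′ , L′-assign , uncolourable) = uncolourable-join⇒kappa≤ G f L′-assign uncolourable
  nonChoosable⇒kappaValue≤ {∞} _ =
    let (z , κ) = kappa-exists G (upTo ∘ f) in z , (upTo ∘ f , upTo-assign , κ) , z ≤∞∞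
    where
    upTo-assign : IsFListAssignment f (upTo ∘ f)
    upTo-assign v = Unique.upTo⁺ (f v) , length-upTo (f v)

corollary21 : ∀ {n} (G : Graph n) (f : Fin n → ℕ) (x : ℕ∞) →
    IsMin (NonChoosableAt G f) x ⇔ IsMin (KappaValue G f) x
corollary21 G f = IsMin-coinitial (kappaValue⇒nonChoosable G f) (nonChoosable⇒kappaValue≤ G f)
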